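{- Let $d,e,r\ge 2$ be integers. Problem $A1(d,e,r)$ admits a maximal solution if and only if all of the following hold: (1) $d=p$ is prime; (2) $r\not\equiv 0\pmod p$; (3) $e$ is a multiple of the radical of $p-1$, i.e., if $p-1=p_1^{n_1}\cdots p_k^{n_k}$ is the prime factorization then $p_1\cdots p_k\mid e$.
   Context: For integers $d,e,r\ge2$, let $S(d,e,r)$ be the smallest set $S$ of positive integers such that (a) $r\in S$; (b) $n\in S$ whenever $n^e\in S$; (c) $(n+d)^e\in S$ whenever $n\in S$ ("smallest" meaning contained in every other such set). This is called the solution of Problem $A1(d,e,r)$. The solution is maximal if $S(d,e,r)=\{n\ge 2: n\not\equiv 0\pmod d\}$. -}

module Defs where

open import Data.Nat using (ℕ; suc; _+_; _^_; _≤_)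
open import Data.Nat.Divisibility using (_∣_)
open import Data.Nat.Primality using (Prime)
open import Relation.Nullary using (¬_)
open import Data.Product using (_×_)
open import Function.Bundles using (_⇔_)

data S (d e r : ℕ) : ℕ → Set where
  base : S d e r r
  root : ∀ {n} → 1 ≤ n → S d e r (n ^ e) → S d e r n
  step : ∀ {n} → S d e r n → S d e r ((n + d) ^ e)

Maximal : ℕ → ℕ → ℕ → Set
Maximal d e r = ∀ n → S d e r n ⇔ (2 ≤ n × ¬ (d ∣ n))

-- rad(m) ∣ e, stated as: every prime factor of m divides e.
RadDivides : ℕ → ℕ → Set
RadDivides m e = ∀ q → Prime q → q ∣ m → q ∣ e

-- Both rules act on residues mod d as n ↦ n ^ e and its inverse, so S carries
-- invariants: for a prime ℓ ∣ d, whether ℓ divides n; and, for d = p prime and a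
-- prime q ∣ p − 1 with q ∤ e, whether n is a q-th power residue, n ^ ((p − 1)/q) ≡ 1
-- (z ^ q ≡ 1 and z ^ e ≡ 1 force z ≡ 1).  Maximality therefore forces d ∤ r; d
-- prime, since a prime factor ℓ < d of d would lie in S together with 1 + d; and
-- rad(p − 1) ∣ e, since otherwise 1, …, m + 1 with m = (p − 1)/q would all be roots
-- of x ^ m − 1, which the finite-difference identity Δᵐ xᵐ = m! rules out mod p.
-- Conversely, if rad(p − 1) ∣ e then p − 1 ∣ e ^ K, so by Fermat rule (c) reaches
-- 1 mod p from r; S is closed under n ↦ n + p, hence contains every large
-- n ^ (e ^ L) ≡ 1, and rule (b) descends from there to n.
module Submission where

open import Defs

module FiniteDifferences where

  open import Data.Nat.Base as ℕ using (ℕ; zero; suc; _!; _^_; _%_; _/_; NonZero)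
  import Data.Nat.Properties as ℕ
  import Data.Nat.Divisibility as ℕ
  open import Data.Nat.DivMod using (m≡m%n+[m/n]*n)
  open import Data.Integer.Base using (ℤ; +_; 0ℤ; _+_; _-_; _*_)
  open import Data.Integer.Properties using (pos-+; pos-*; *-zeroʳ; +-identityˡ; +-identityʳ; +-inverseʳ)
  open import Data.Integer.Divisibility.Signed using (_∣_; divides; ∣m∣n⇒∣m-n; ∣⇒∣ᵤ)
  open import Data.Integer.Tactic.RingSolver using (solve-∀)
  open import Relation.Binary.PropositionalEquality

  Δ : ℕ → (ℕ → ℤ) → ℕ → ℤ
  Δ zero    f n = f n
  Δ (suc k) f n = Δ k f (suc n) - Δ k f n

  Δ-cong : ∀ k {f g : ℕ → ℤ} → (∀ x → f x ≡ g x) → ∀ n → Δ k f n ≡ Δ k g n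
  Δ-cong zero    f≗g n = f≗g n
  Δ-cong (suc k) f≗g n = cong₂ _-_ (Δ-cong k f≗g (suc n)) (Δ-cong k f≗g n)

  Δ-distrib-minus : ∀ k (f g : ℕ → ℤ) n → Δ k (λ x → f x - g x) n ≡ Δ k f n - Δ k g n
  Δ-distrib-minus zero    f g n = refl
  Δ-distrib-minus (suc k) f g n = trans
    (cong₂ _-_ (Δ-distrib-minus k f g (suc n)) (Δ-distrib-minus k f g n))
    (interchange (Δ k f (suc n)) (Δ k g (suc n)) (Δ k f n) (Δ k g n))
    where
    interchange : ∀ a b c d → (a - b) - (c - d) ≡ (a - c) - (b - d)
    interchange = solve-∀

  Δ-const : ∀ k (c : ℤ) n → Δ (suc k) (λ _ → c) n ≡ 0ℤ
  Δ-const zero    c n = +-inverseʳ c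
  Δ-const (suc k) c n = cong₂ _-_ (Δ-const k c (suc n)) (Δ-const k c n)

  Δ-leibniz : ∀ k (f : ℕ → ℤ) n →
    Δ (suc k) (λ x → + x * f x) n ≡ + n * Δ (suc k) f n + + suc k * Δ k f (suc n)
  Δ-leibniz zero f n = leibniz-base (+ n) (f (suc n)) (f n)
    where
    leibniz-base : ∀ n a b → (+ 1 + n) * a - n * b ≡ n * (a - b) + + 1 * a
    leibniz-base = solve-∀
  Δ-leibniz (suc k) f n = trans
    (cong₂ _-_ (Δ-leibniz k f (suc n)) (Δ-leibniz k f n))
    (leibniz-step (+ n) (+ k) (Δ (suc k) f n) (Δ k f (suc (suc n))) (Δ k f (suc n)))
    where
    leibniz-step : ∀ n k a b c →
      ((+ 1 + n) * (b - c) + (+ 1 + k) * b) - (n * a + (+ 1 + k) * c)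
        ≡ n * ((b - c) - a) + (+ 1 + (+ 1 + k)) * (b - c)
    leibniz-step = solve-∀

  Δ-pow : ∀ m n → Δ m (λ x → + (x ^ m)) n ≡ + (m !)
  Δ-pow zero    n = refl
  Δ-pow (suc m) n = begin
    Δ (suc m) (λ x → + (x ^ suc m)) n
      ≡⟨ Δ-cong (suc m) (λ x → pos-* x (x ^ m)) n ⟩
    Δ (suc m) (λ x → + x * + (x ^ m)) n
      ≡⟨ Δ-leibniz m (λ x → + (x ^ m)) n ⟩
    + n * Δ (suc m) (λ x → + (x ^ m)) n + + suc m * Δ m (λ x → + (x ^ m)) (suc n)
      ≡⟨ cong₂ (λ a b → + n * a + + suc m * b) top-difference (Δ-pow m (suc n)) ⟩
    + n * 0ℤ + + suc m * + (m !)
      ≡⟨ trans (cong (_+ + suc m * + (m !)) (*-zeroʳ (+ n))) (+-identityˡ _) ⟩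
    + suc m * + (m !)
      ≡⟨ pos-* (suc m) (m !) ⟨
    + (suc m !) ∎
    where
    open ≡-Reasoning
    top-difference : Δ (suc m) (λ x → + (x ^ m)) n ≡ 0ℤ
    top-difference = trans (cong₂ _-_ (Δ-pow m (suc n)) (Δ-pow m n)) (+-inverseʳ (+ (m !)))

  ∣Δ : ∀ k {d} {f : ℕ → ℤ} a → (∀ i → i ℕ.≤ k → d ∣ f (a ℕ.+ i)) → d ∣ Δ k f a
  ∣Δ zero    {d} {f} a d∣f = subst (λ x → d ∣ f x) (ℕ.+-identityʳ a) (d∣f 0 ℕ.z≤n)
  ∣Δ (suc k) {d} {f} a d∣f = ∣m∣n⇒∣m-n
    (∣Δ k (suc a) (λ i i≤k → subst (λ x → d ∣ f x) (ℕ.+-suc a i) (d∣f (suc i) (ℕ.s≤s i≤k))))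
    (∣Δ k a (λ i i≤k → d∣f i (ℕ.m≤n⇒m≤1+n i≤k)))

  %≡%⇒∣- : ∀ {p} .{{_ : NonZero p}} x y → x % p ≡ y % p → + p ∣ + x - + y
  %≡%⇒∣- {p} x y x≡y = divides (+ (x / p) - + (y / p)) (begin
    + x - + y
      ≡⟨ cong₂ (λ u v → + u - + v) (m≡m%n+[m/n]*n x p)
           (trans (m≡m%n+[m/n]*n y p) (cong (ℕ._+ y / p ℕ.* p) (sym x≡y))) ⟩
    + (x % p ℕ.+ x / p ℕ.* p) - + (x % p ℕ.+ y / p ℕ.* p)
      ≡⟨ cong₂ _-_ (split (x % p) (x / p)) (split (x % p) (y / p)) ⟩
    (+ (x % p) + + (x / p) * + p) - (+ (x % p) + + (y / p) * + p)
      ≡⟨ cancel (+ (x % p)) (+ (x / p)) (+ (y / p)) (+ p) ⟩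
    (+ (x / p) - + (y / p)) * + p ∎)
    where
    open ≡-Reasoning
    split : ∀ r q → + (r ℕ.+ q ℕ.* p) ≡ + r + + q * + p
    split r q = trans (pos-+ r (q ℕ.* p)) (cong (λ z → + r + z) (pos-* q p))
    cancel : ∀ r a b p → (r + a * p) - (r + b * p) ≡ (a - b) * p
    cancel = solve-∀

  powers-constant-mod⇒∣! : ∀ {p} .{{_ : NonZero p}} m .{{_ : NonZero m}} a c →
    (∀ i → i ℕ.≤ m → (a ℕ.+ i) ^ m % p ≡ c % p) → p ℕ.∣ m !
  powers-constant-mod⇒∣! {p} m@(suc k) a c const = ∣⇒∣ᵤ (subst (+ p ∣_) Δh≡m! p∣Δh)
    where
    h : ℕ → ℤ
    h x = + (x ^ m) - + c
    p∣Δh : + p ∣ Δ m h a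
    p∣Δh = ∣Δ m a (λ i i≤m → %≡%⇒∣- _ c (const i i≤m))
    Δh≡m! : Δ m h a ≡ + (m !)
    Δh≡m! = trans (Δ-distrib-minus m (λ x → + (x ^ m)) (λ _ → + c) a)
      (trans (cong₂ _-_ (Δ-pow m a) (Δ-const k (+ c) a)) (+-identityʳ _))

open FiniteDifferences using (powers-constant-mod⇒∣!)

open import Data.Nat.Base
open import Data.Nat.Properties
open import Data.Nat.Divisibility
open import Data.Nat.DivMod
open import Data.Nat.Primality
open import Data.Nat.Primality.Factorisation using (factorise; PrimeFactorisation)
open import Data.Nat.Coprimality using (Coprime; coprime-Bézout)
open import Data.Nat.GCD using (module Bézout)
open import Data.Nat.ListAction using (product)
open import Data.Nat.Combinatorics using (_C_; nCn≡1; nCk≡n!/k![n-k]!; k![n∸k]!∣n!)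
open import Data.Fin.Base using (zero; suc; toℕ; inject₁; fromℕ)
open import Data.Fin.Properties using (toℕ-inject₁; toℕ<n; toℕ-fromℕ)
open import Data.Vec.Functional using (Vector; init; tail)
open import Data.List.Base using ([]; _∷_; length)
open import Data.List.Relation.Unary.All using (All; []; _∷_)
open import Data.Product using (∃-syntax; _×_; _,_; proj₂)
open import Data.Sum using (inj₁; inj₂)
open import Function.Base using (id; _∘_)
open import Function.Bundles using (_⇔_; mk⇔; Equivalence)
import Function.Properties.Equivalence as ⇔
open import Relation.Nullary using (¬_; contradiction; yes; no)
open import Relation.Nullary.Decidable using (decidable-stable)
open import Relation.Binary.PropositionalEquality
import Algebra.Definitions.RawSemiring +-*-rawSemiring as Semiring
open import Algebra.Properties.CommutativeSemiring.Binomial +-*-commutativeSemiring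
  using (binomialTerm; theorem)
open import Algebra.Properties.Monoid.Sum +-0-monoid using (sum; sum-init-last)

open Equivalence using (to; from)

module _ {n : ℕ} .{{_ : NonZero n}} where

  %-*-cong : ∀ {a b c d} → a % n ≡ b % n → c % n ≡ d % n → a * c % n ≡ b * d % n
  %-*-cong {a} {b} {c} {d} a≡b c≡d = begin
    a * c % n             ≡⟨ %-distribˡ-* a c n ⟩
    (a % n) * (c % n) % n ≡⟨ cong₂ (λ u v → u * v % n) a≡b c≡d ⟩
    (b % n) * (d % n) % n ≡⟨ %-distribˡ-* b d n ⟨
    b * d % n             ∎
    where open ≡-Reasoning

  %-^-cong : ∀ {a b} k → a % n ≡ b % n → a ^ k % n ≡ b ^ k % n
  %-^-cong zero    a≡b = refl
  %-^-cong (suc k) a≡b = %-*-cong a≡b (%-^-cong k a≡b)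

  %≡1⇒1%≡1 : ∀ {a} → a % n ≡ 1 → 1 % n ≡ 1
  %≡1⇒1%≡1 {a} a≡1 = trans (%-congˡ (sym a≡1)) (trans (m%n%n≡m%n a n) a≡1)

  ^%≡1 : ∀ {a} k → a % n ≡ 1 → a ^ k % n ≡ 1
  ^%≡1 {a} k a≡1 = begin
    a ^ k % n ≡⟨ %-^-cong k (trans a≡1 (sym (%≡1⇒1%≡1 a≡1))) ⟩
    1 ^ k % n ≡⟨ %-congˡ (^-zeroˡ k) ⟩
    1 % n     ≡⟨ %≡1⇒1%≡1 a≡1 ⟩
    1         ∎
    where open ≡-Reasoning

  %≡%⇒∣∸ : ∀ x y → x % n ≡ y % n → n ∣ x ∸ y
  %≡%⇒∣∸ x y x≡y = divides (x / n ∸ y / n) (begin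
    x ∸ y
      ≡⟨ cong₂ _∸_ (m≡m%n+[m/n]*n x n) (trans (m≡m%n+[m/n]*n y n) (cong (_+ y / n * n) (sym x≡y))) ⟩
    (x % n + x / n * n) ∸ (x % n + y / n * n) ≡⟨ [m+n]∸[m+o]≡n∸o (x % n) _ _ ⟩
    x / n * n ∸ y / n * n                     ≡⟨ *-distribʳ-∸ n (x / n) (y / n) ⟨
    (x / n ∸ y / n) * n                       ∎)
    where open ≡-Reasoning

  ^%≡1-Bézout : ∀ {z a b} x y → 1 + y * b ≡ x * a → z ^ a % n ≡ 1 → z ^ b % n ≡ 1 → z % n ≡ 1
  ^%≡1-Bézout {z} {a} {b} x y 1+yb≡xa za≡1 zb≡1 = begin
    z % n                 ≡⟨ %-congˡ (*-identityʳ z) ⟨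
    z * 1 % n             ≡⟨ %-*-cong {z} refl (trans (^%≡1 y zb≡1) (sym (%≡1⇒1%≡1 zb≡1))) ⟨
    z * (z ^ b) ^ y % n   ≡⟨ %-congˡ (cong (z *_) (^-*-assoc z b y)) ⟩
    z ^ (1 + b * y) % n   ≡⟨ %-congˡ (cong (λ k → z ^ (1 + k)) (*-comm b y)) ⟩
    z ^ (1 + y * b) % n   ≡⟨ %-congˡ (cong (z ^_) 1+yb≡xa) ⟩
    z ^ (x * a) % n       ≡⟨ %-congˡ (cong (z ^_) (*-comm x a)) ⟩
    z ^ (a * x) % n       ≡⟨ %-congˡ (^-*-assoc z a x) ⟨
    (z ^ a) ^ x % n       ≡⟨ ^%≡1 x za≡1 ⟩
    1                     ∎
    where open ≡-Reasoning

  ^%≡1-coprime : ∀ {z a b} → Coprime a b → z ^ a % n ≡ 1 → z ^ b % n ≡ 1 → z % n ≡ 1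
  ^%≡1-coprime a⊥b za≡1 zb≡1 with coprime-Bézout a⊥b
  ... | Bézout.+- x y 1+yb≡xa = ^%≡1-Bézout x y 1+yb≡xa za≡1 zb≡1
  ... | Bézout.-+ x y 1+xa≡yb = ^%≡1-Bézout y x 1+xa≡yb zb≡1 za≡1

prime⇒2≤ : ∀ {p} → Prime p → 2 ≤ p
prime⇒2≤ {p} p-prime = nonTrivial⇒n>1 p {{prime⇒nonTrivial p-prime}}

prime∤! : ∀ {p} m → Prime p → m < p → ¬ p ∣ m !
prime∤! zero    p-prime _   p∣1 = ¬prime[1] (subst Prime (∣1⇒≡1 p∣1) p-prime)
prime∤! (suc m) p-prime m<p p∣ with euclidsLemma (suc m) (m !) p-prime p∣
... | inj₁ p∣1+m = <⇒≱ m<p (∣⇒≤ p∣1+m)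
... | inj₂ p∣m!  = prime∤! m p-prime (<-trans (n<1+n m) m<p) p∣m!

prime∣pCk : ∀ {p k} → Prime p → 0 < k → k < p → p ∣ p C k
prime∣pCk {p@(suc p-1)} {k} p-prime 0<k k<p
  with euclidsLemma (k ! * (p ∸ k) !) (p C k) p-prime p∣p!
  where
  p∣p! : p ∣ k ! * (p ∸ k) ! * (p C k)
  p∣p! = subst (p ∣_) (begin
      p !
        ≡⟨ m*[n/m]≡n {{k !* (p ∸ k) !≢0}} (k![n∸k]!∣n! (<⇒≤ k<p)) ⟨
      k ! * (p ∸ k) ! * (p ! / (k ! * (p ∸ k) !)) {{k !* (p ∸ k) !≢0}}
        ≡⟨ cong (k ! * (p ∸ k) ! *_) (nCk≡n!/k![n-k]! (<⇒≤ k<p)) ⟨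
      k ! * (p ∸ k) ! * (p C k) ∎) (m∣m*n (p-1 !))
    where open ≡-Reasoning
... | inj₂ p∣pCk = p∣pCk
... | inj₁ p∣k![p-k]! with euclidsLemma (k !) ((p ∸ k) !) p-prime p∣k![p-k]!
...   | inj₁ p∣k!     = contradiction p∣k! (prime∤! k p-prime k<p)
...   | inj₂ p∣[p-k]! = contradiction p∣[p-k]! (prime∤! (p ∸ k) p-prime (∸-monoʳ-< 0<k (<⇒≤ k<p)))

×≡* : ∀ n x → n Semiring.× x ≡ n * x
×≡* zero    x = refl
×≡* (suc n) x = cong (x +_) (×≡* n x)

^≡^ : ∀ x n → x Semiring.^ n ≡ x ^ n
^≡^ x zero    = refl
^≡^ x (suc n) = cong (x *_) (^≡^ x n)

binomialTerm≡ : ∀ x y n k → binomialTerm x y n k ≡ (n C toℕ k) * (x ^ toℕ k * y ^ (n ∸ toℕ k))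
binomialTerm≡ x y n k = trans (×≡* (n C toℕ k) _)
  (cong ((n C toℕ k) *_) (cong₂ _*_ (^≡^ x (toℕ k)) (^≡^ y (n ∸ toℕ k))))

∣-sum : ∀ {d n} (t : Vector ℕ n) → (∀ i → d ∣ t i) → d ∣ sum t
∣-sum {n = zero}  t d∣t = _ ∣0
∣-sum {n = suc n} t d∣t = ∣m∣n⇒∣m+n (d∣t zero) (∣-sum (tail t) (λ i → d∣t (suc i)))

freshman's-dream : ∀ {p} .{{_ : NonZero p}} x → Prime p → (1 + x) ^ p % p ≡ (1 + x ^ p) % p
freshman's-dream {p@(suc p-1)} x p-prime = begin
  (1 + x) ^ p % p
    ≡⟨ %-congˡ (trans (sym (^≡^ (1 + x) p)) (theorem p 1 x)) ⟩
  sum t % p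
    ≡⟨ %-congˡ (cong (t zero +_) (sum-init-last (tail t))) ⟩
  (t zero + (middle + t (fromℕ p))) % p
    ≡⟨ %-congˡ (cong₂ (λ a b → a + (middle + b)) first-term last-term) ⟩
  (x ^ p + (middle + 1)) % p
    ≡⟨ %-congˡ (rearrange (x ^ p) middle) ⟩
  (middle + (1 + x ^ p)) % p
    ≡⟨ %-remove-+ˡ (1 + x ^ p) (∣-sum (init (tail t)) p∣middle-term) ⟩
  (1 + x ^ p) % p ∎
  where
  open ≡-Reasoning
  t = binomialTerm 1 x p
  middle = sum (init (tail t))
  rearrange : ∀ a b → a + (b + 1) ≡ b + (1 + a)
  rearrange a b = trans (+-comm a (b + 1)) (+-assoc b 1 a)
  first-term : t zero ≡ x ^ p
  first-term = trans (binomialTerm≡ 1 x p zero) (trans (*-identityˡ _) (*-identityˡ _))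
  last-term : t (fromℕ p) ≡ 1
  last-term = begin
    t (fromℕ p)
      ≡⟨ binomialTerm≡ 1 x p (fromℕ p) ⟩
    (p C toℕ (fromℕ p)) * (1 ^ toℕ (fromℕ p) * x ^ (p ∸ toℕ (fromℕ p)))
      ≡⟨ cong (λ k → (p C k) * (1 ^ k * x ^ (p ∸ k))) (toℕ-fromℕ p) ⟩
    (p C p) * (1 ^ p * x ^ (p ∸ p))
      ≡⟨ cong₂ (λ c k → c * (1 ^ p * x ^ k)) (nCn≡1 p) (n∸n≡0 p) ⟩
    1 * (1 ^ p * 1)
      ≡⟨ trans (*-identityˡ _) (trans (*-identityʳ _) (^-zeroˡ p)) ⟩
    1 ∎
  p∣middle-term : ∀ i → p ∣ init (tail t) i
  p∣middle-term i = subst (p ∣_) (sym (binomialTerm≡ 1 x p (suc (inject₁ i))))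
    (∣m⇒∣m*n _ (prime∣pCk p-prime (s≤s z≤n) (s≤s (subst (_< p-1) (sym (toℕ-inject₁ i)) (toℕ<n i)))))

fermat : ∀ {p} .{{_ : NonZero p}} a → Prime p → a ^ p % p ≡ a % p
fermat {suc _} zero    p-prime = refl
fermat {p}     (suc a) p-prime = begin
  (1 + a) ^ p % p         ≡⟨ freshman's-dream a p-prime ⟩
  (1 + a ^ p) % p         ≡⟨ %-distribˡ-+ 1 (a ^ p) p ⟩
  (1 % p + a ^ p % p) % p ≡⟨ cong (λ b → (1 % p + b) % p) (fermat a p-prime) ⟩
  (1 % p + a % p) % p     ≡⟨ %-distribˡ-+ 1 a p ⟨
  (1 + a) % p             ∎
  where open ≡-Reasoning

fermat′ : ∀ {p} .{{_ : NonZero p}} a → Prime p → ¬ p ∣ a → a ^ (p ∸ 1) % p ≡ 1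
fermat′ {p@(suc p-1)} a p-prime p∤a = begin
  y % p             ≡⟨ %-congˡ (m+[n∸m]≡n 1≤y) ⟨
  (1 + (y ∸ 1)) % p ≡⟨ %-remove-+ʳ 1 p∣y∸1 ⟩
  1 % p             ≡⟨ m<n⇒m%n≡m (prime⇒2≤ p-prime) ⟩
  1                 ∎
  where
  open ≡-Reasoning
  y = a ^ p-1
  1≤y : 1 ≤ y
  1≤y = m^n>0 a {{≢-nonZero (λ { refl → p∤a (p ∣0) })}} p-1
  p∣a[y∸1] : p ∣ a * (y ∸ 1)
  p∣a[y∸1] = subst (p ∣_) (sym (*-distribˡ-∸ a y 1))
    (%≡%⇒∣∸ (a * y) (a * 1) (trans (fermat a p-prime) (%-congˡ (sym (*-identityʳ a)))))
  p∣y∸1 : p ∣ y ∸ 1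
  p∣y∸1 with euclidsLemma a (y ∸ 1) p-prime p∣a[y∸1]
  ... | inj₁ p∣a   = contradiction p∣a p∤a
  ... | inj₂ p∣y∸1 = p∣y∸1

fermat-multiple : ∀ {p k} .{{_ : NonZero p}} a → Prime p → ¬ p ∣ a → (p ∸ 1) ∣ k → a ^ k % p ≡ 1
fermat-multiple {p} a p-prime p∤a (divides t refl) = begin
  a ^ (t * (p ∸ 1)) % p ≡⟨ %-congˡ (cong (a ^_) (*-comm t (p ∸ 1))) ⟩
  a ^ ((p ∸ 1) * t) % p ≡⟨ %-congˡ (^-*-assoc a (p ∸ 1) t) ⟨
  (a ^ (p ∸ 1)) ^ t % p ≡⟨ ^%≡1 t (fermat′ a p-prime p∤a) ⟩
  1                     ∎
  where open ≡-Reasoning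

prime∣^⇒∣ : ∀ {p m} k → Prime p → p ∣ m ^ k → p ∣ m
prime∣^⇒∣ zero p-prime p∣1 = contradiction (subst Prime (∣1⇒≡1 p∣1) p-prime) ¬prime[1]
prime∣^⇒∣ {m = m} (suc k) p-prime p∣m^[1+k] with euclidsLemma m (m ^ k) p-prime p∣m^[1+k]
... | inj₁ p∣m   = p∣m
... | inj₂ p∣m^k = prime∣^⇒∣ k p-prime p∣m^k

∣⇒∣^ : ∀ {d m k} → 1 ≤ k → d ∣ m → d ∣ m ^ k
∣⇒∣^ {m = m} {suc k} _ d∣m = ∣m⇒∣m*n (m ^ k) d∣m

∣n∧∣1+n⇒≡1 : ∀ {ℓ n} → ℓ ∣ n → ℓ ∣ 1 + n → ℓ ≡ 1
∣n∧∣1+n⇒≡1 {ℓ} {n} ℓ∣n ℓ∣1+n = ∣1⇒≡1 (∣m+n∣m⇒∣n (subst (ℓ ∣_) (+-comm 1 n) ℓ∣1+n) ℓ∣n)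

prime∤⇒coprime : ∀ {q e} → Prime q → ¬ q ∣ e → Coprime q e
prime∤⇒coprime q-prime q∤e (i∣q , i∣e) with prime⇒irreducible q-prime i∣q
... | inj₁ i≡1 = i≡1
... | inj₂ refl = contradiction i∣e q∤e

∃-prime-divisor : ∀ {n} → 2 ≤ n → ∃[ ℓ ] Prime ℓ × ℓ ∣ n
∃-prime-divisor {n} n≥2 = first-factor (factors f) (isFactorisation f) (factorsPrime f)
  where
  open PrimeFactorisation
  f = factorise n {{>-nonZero (<-trans z<s n≥2)}}
  first-factor : ∀ as → n ≡ product as → All Prime as → ∃[ ℓ ] Prime ℓ × ℓ ∣ n
  first-factor []       n≡1 _              = contradiction n≡1 (>⇒≢ n≥2)
  first-factor (a ∷ as) n≡a*as (a-prime ∷ _) = a , a-prime , subst (a ∣_) (sym n≡a*as) (m∣m*n (product as))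

¬prime⇒∃-smaller-prime-divisor : ∀ {n} → 2 ≤ n → ¬ Prime n → ∃[ ℓ ] Prime ℓ × ℓ ∣ n × ℓ < n
¬prime⇒∃-smaller-prime-divisor {n} n≥2 ¬prime
  with composite {q} q<n q∣n ← ¬prime⇒composite {{n>1⇒nonTrivial n≥2}} ¬prime
  with ℓ , ℓ-prime , ℓ∣q ← ∃-prime-divisor (nonTrivial⇒n>1 q)
  = ℓ , ℓ-prime , ∣-trans ℓ∣q q∣n , ≤-<-trans (∣⇒≤ {{nonTrivial⇒nonZero q}} ℓ∣q) q<n

product∣^length : ∀ {e} as → All Prime as → RadDivides (product as) e → product as ∣ e ^ length as
product∣^length []       []                 rad = ∣-refl
product∣^length (a ∷ as) (a-prime ∷ primes) rad = *-pres-∣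
  (rad a a-prime (m∣m*n (product as)))
  (product∣^length as primes (λ q q-prime q∣as → rad q q-prime (∣-trans q∣as (n∣m*n a))))

radDivides⇒∣^ : ∀ {m e} .{{_ : NonZero m}} → RadDivides m e → ∃[ K ] m ∣ e ^ K
radDivides⇒∣^ {m} {e} rad = length (factors f) ,
  subst (_∣ e ^ length (factors f)) (sym (isFactorisation f))
    (product∣^length (factors f) (factorsPrime f)
      (λ q q-prime q∣ → rad q q-prime (subst (q ∣_) (sym (isFactorisation f)) q∣)))
  where
  open PrimeFactorisation
  f = factorise m

^-comm : ∀ a b c → (a ^ b) ^ c ≡ (a ^ c) ^ b
^-comm a b c = trans (^-*-assoc a b c) (trans (cong (a ^_) (*-comm b c)) (sym (^-*-assoc a c b)))

m<b^m : ∀ {b} m → 1 < b → m < b ^ m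
m<b^m zero    1<b = z<s
m<b^m {b} (suc m) 1<b = ≤-<-trans (m<b^m m 1<b) (^-monoʳ-< b 1<b (n<1+n m))

n≤n^k : ∀ {n k} → 1 ≤ n → 1 ≤ k → n ≤ n ^ k
n≤n^k {n} {k} 1≤n 1≤k = subst (_≤ n ^ k) (^-identityʳ n) (^-monoʳ-≤ n {{>-nonZero 1≤n}} 1≤k)

module _ {d e r : ℕ} where

  S-≥2 : 2 ≤ r → 1 ≤ e → ∀ {n} → S d e r n → 2 ≤ n
  S-≥2 r≥2 e≥1 base = r≥2
  S-≥2 r≥2 e≥1 (root {n} n≥1 s) = root-≥2 n≥1 (S-≥2 r≥2 e≥1 s)
    where
    root-≥2 : ∀ {n} → 1 ≤ n → 2 ≤ n ^ e → 2 ≤ n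
    root-≥2 {1}           _ 1^e≥2 = contradiction (subst (2 ≤_) (^-zeroˡ e) 1^e≥2) (λ { (s≤s ()) })
    root-≥2 {suc (suc n)} _ _   = s≤s (s≤s z≤n)
  S-≥2 r≥2 e≥1 (step {n} s) = ≤-trans n+d≥2 (n≤n^k (≤-trans (s≤s z≤n) n+d≥2) e≥1)
    where n+d≥2 = ≤-trans (S-≥2 r≥2 e≥1 s) (m≤m+n n d)

  S-prime-divisor-invariant : ∀ {ℓ} → Prime ℓ → ℓ ∣ d → 1 ≤ e → ∀ {n} → S d e r n → ℓ ∣ n ⇔ ℓ ∣ r
  S-prime-divisor-invariant ℓ-prime ℓ∣d e≥1 base = mk⇔ id id
  S-prime-divisor-invariant ℓ-prime ℓ∣d e≥1 (root _ s) =
    mk⇔ (to IH ∘ ∣⇒∣^ e≥1) (prime∣^⇒∣ e ℓ-prime ∘ from IH)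
    where IH = S-prime-divisor-invariant ℓ-prime ℓ∣d e≥1 s
  S-prime-divisor-invariant {ℓ} ℓ-prime ℓ∣d e≥1 (step {n} s) =
    mk⇔ (λ ℓ∣[n+d]^e → to IH (∣m+n∣m⇒∣n (subst (ℓ ∣_) (+-comm n d) (prime∣^⇒∣ e ℓ-prime ℓ∣[n+d]^e)) ℓ∣d))
        (λ ℓ∣r → ∣⇒∣^ e≥1 (∣m∣n⇒∣m+n (from IH ℓ∣r) ℓ∣d))
    where IH = S-prime-divisor-invariant ℓ-prime ℓ∣d e≥1 s

  S-∤ : Prime d → ¬ d ∣ r → 1 ≤ e → ∀ {n} → S d e r n → ¬ d ∣ n
  S-∤ d-prime d∤r e≥1 s = d∤r ∘ to (S-prime-divisor-invariant d-prime ∣-refl e≥1 s)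

  module _ .{{_ : NonZero d}} where

    S-+d : ∀ {n} → S d e r n → S d e r (n + d)
    S-+d {n} s = root (≤-trans (>-nonZero⁻¹ d) (m≤n+m d n)) (step s)

    S-+*d : ∀ {n} → S d e r n → ∀ k → S d e r (n + k * d)
    S-+*d {n} s zero    = subst (S d e r) (sym (+-identityʳ n)) s
    S-+*d {n} s (suc k) = subst (S d e r) (trans (+-assoc n (k * d) d) (cong (n +_) (+-comm (k * d) d)))
      (S-+d (S-+*d s k))

    S-upward-%-closed : ∀ {x y} → S d e r x → x ≤ y → x % d ≡ y % d → S d e r y
    S-upward-%-closed {x} {y} s x≤y x≡y with divides k y∸x≡k*d ← %≡%⇒∣∸ y x (sym x≡y) =
      subst (S d e r) (trans (cong (x +_) (sym y∸x≡k*d)) (m+[n∸m]≡n x≤y)) (S-+*d s k)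

    S-orbit : ∀ k → ∃[ x ] S d e r x × x % d ≡ r ^ (e ^ k) % d
    S-orbit zero    = r , base , %-congˡ (sym (*-identityʳ r))
    S-orbit (suc k) with x , s , x≡r^e^k ← S-orbit k = (x + d) ^ e , step s , (begin
      (x + d) ^ e % d         ≡⟨ %-^-cong e ([m+n]%n≡m%n x d) ⟩
      x ^ e % d               ≡⟨ %-^-cong e x≡r^e^k ⟩
      (r ^ (e ^ k)) ^ e % d   ≡⟨ %-congˡ (^-*-assoc r (e ^ k) e) ⟩
      r ^ (e ^ k * e) % d     ≡⟨ %-congˡ (cong (r ^_) (*-comm (e ^ k) e)) ⟩
      r ^ (e ^ suc k) % d     ∎)
      where open ≡-Reasoning

  S-root-iterate : ∀ {n} → 1 ≤ n → ∀ i → S d e r (n ^ (e ^ i)) → S d e r n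
  S-root-iterate {n} n≥1 zero    s = subst (S d e r) (*-identityʳ n) s
  S-root-iterate {n} n≥1 (suc i) s = S-root-iterate n≥1 i (root (m^n>0 n {{>-nonZero n≥1}} (e ^ i))
    (subst (S d e r) (trans (cong (n ^_) (*-comm e (e ^ i))) (sym (^-*-assoc n (e ^ i) e))) s))

  module _ .{{_ : NonZero d}} (d-prime : Prime d) (d∤r : ¬ d ∣ r) (e≥1 : 1 ≤ e)
           {m q} (d∸1≡m*q : d ∸ 1 ≡ m * q) (q⊥e : Coprime q e) where

    ^m%≡1⇔^e^m%≡1 : ∀ {n} → ¬ d ∣ n → n ^ m % d ≡ 1 ⇔ (n ^ e) ^ m % d ≡ 1
    ^m%≡1⇔^e^m%≡1 {n} d∤n = mk⇔
      (λ n^m≡1 → trans (cong (_% d) (^-comm n e m)) (^%≡1 e n^m≡1))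
      (λ n^e^m≡1 → ^%≡1-coprime q⊥e n^m^q≡1 (trans (cong (_% d) (^-comm n m e)) n^e^m≡1))
      where
      n^m^q≡1 : (n ^ m) ^ q % d ≡ 1
      n^m^q≡1 = trans (%-congˡ (trans (^-*-assoc n m q) (cong (n ^_) (sym d∸1≡m*q)))) (fermat′ n d-prime d∤n)

    S-power-residue-invariant : ∀ {n} → S d e r n → n ^ m % d ≡ 1 ⇔ r ^ m % d ≡ 1
    S-power-residue-invariant base = ⇔.refl
    S-power-residue-invariant (root {n} n≥1 s) =
      ⇔.trans (^m%≡1⇔^e^m%≡1 (S-∤ d-prime d∤r e≥1 (root n≥1 s))) (S-power-residue-invariant s)
    S-power-residue-invariant (step {n} s) = ⇔.trans (mk⇔ (trans (sym shift)) (trans shift))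
      (⇔.trans (⇔.sym (^m%≡1⇔^e^m%≡1 (S-∤ d-prime d∤r e≥1 s))) (S-power-residue-invariant s))
      where
      shift : ((n + d) ^ e) ^ m % d ≡ (n ^ e) ^ m % d
      shift = %-^-cong m (%-^-cong e ([m+n]%n≡m%n n d))

module _ {d e r : ℕ} (maximal : Maximal d e r) where

  maximal-member : ∀ {n} → 2 ≤ n → ¬ d ∣ n → S d e r n
  maximal-member n≥2 d∤n = from (maximal _) (n≥2 , d∤n)

  maximal⇒∤ : ¬ d ∣ r
  maximal⇒∤ = proj₂ (to (maximal r) base)

  maximal-member-1+d : 2 ≤ d → S d e r (1 + d)
  maximal-member-1+d d≥2 = maximal-member (s≤s (≤-trans (s≤s z≤n) d≥2))
    (λ d∣1+d → contradiction (∣n∧∣1+n⇒≡1 ∣-refl d∣1+d) (>⇒≢ d≥2))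

  maximal⇒prime : 2 ≤ d → 1 ≤ e → Prime d
  maximal⇒prime d≥2 e≥1 = decidable-stable (prime? d) λ ¬prime →
    let ℓ , ℓ-prime , ℓ∣d , ℓ<d = ¬prime⇒∃-smaller-prime-divisor d≥2 ¬prime
        ℓ⇔r = S-prime-divisor-invariant ℓ-prime ℓ∣d e≥1
        ℓ∣r = to (ℓ⇔r (maximal-member (prime⇒2≤ ℓ-prime) (>⇒∤ {{prime⇒nonZero ℓ-prime}} ℓ<d))) ∣-refl
        ℓ∣1+d = from (ℓ⇔r (maximal-member-1+d d≥2)) ℓ∣r
    in ¬prime[1] (subst Prime (∣n∧∣1+n⇒≡1 ℓ∣d ℓ∣1+d) ℓ-prime)

  maximal⇒radDivides : 2 ≤ d → 1 ≤ e → Prime d → RadDivides (d ∸ 1) e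
  maximal⇒radDivides d≥2 e≥1 d-prime q q-prime (divides m d∸1≡m*q) with q ∣? e
  ... | yes q∣e = q∣e
  ... | no  q∤e = contradiction (powers-constant-mod⇒∣! m 1 1 roots-of-unity) (prime∤! m d-prime m<d)
    where
    instance
      _ = prime⇒nonZero d-prime
      _ = ≢-nonZero (λ { refl → <⇒≢ (m<n⇒0<n∸m d≥2) (sym d∸1≡m*q) })
    1+m<d : 1 + m < d
    1+m<d = subst (_≤ d) (+-comm (suc m) 1) (m≤o∸n⇒m+n≤o (suc m) (≤-trans (s≤s z≤n) d≥2)
      (subst (m <_) (sym d∸1≡m*q) (m<m*n m q (prime⇒2≤ q-prime))))
    m<d : m < d
    m<d = <-trans (n<1+n m) 1+m<d
    1%d≡1 : 1 % d ≡ 1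
    1%d≡1 = m<n⇒m%n≡m d≥2
    ^m⇔r^m : ∀ {n} → S d e r n → n ^ m % d ≡ 1 ⇔ r ^ m % d ≡ 1
    ^m⇔r^m = S-power-residue-invariant d-prime maximal⇒∤ e≥1 {m = m} d∸1≡m*q (prime∤⇒coprime q-prime q∤e)
    r^m≡1 : r ^ m % d ≡ 1
    r^m≡1 = to (^m⇔r^m (maximal-member-1+d d≥2)) (^%≡1 m (trans ([m+n]%n≡m%n 1 d) 1%d≡1))
    roots-of-unity : ∀ i → i ≤ m → (1 + i) ^ m % d ≡ 1 % d
    roots-of-unity zero    _     = cong (_% d) (^-zeroˡ m)
    roots-of-unity (suc i) 1+i≤m = trans (from (^m⇔r^m (maximal-member (s≤s (s≤s z≤n)) (>⇒∤ 2+i<d))) r^m≡1) (sym 1%d≡1)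
      where
      2+i<d : 2 + i < d
      2+i<d = ≤-<-trans (s≤s 1+i≤m) 1+m<d

module _ {p e r : ℕ} (p-prime : Prime p) (e≥2 : 2 ≤ e) (r≥2 : 2 ≤ r) (p∤r : ¬ p ∣ r)
         (rad : RadDivides (p ∸ 1) e) where

  private
    instance
      _ = prime⇒nonZero p-prime
      _ = >-nonZero (m<n⇒0<n∸m (prime⇒2≤ p-prime))
    e≥1 : 1 ≤ e
    e≥1 = ≤-trans (s≤s z≤n) e≥2

  S-complete : ∀ {n} → 2 ≤ n → ¬ p ∣ n → S p e r n
  S-complete {n} n≥2 p∤n
    with K , p∸1∣e^K ← radDivides⇒∣^ rad
    with x , x∈S , x≡r^e^K ← S-orbit {p} {e} {r} K
    = S-root-iterate (≤-trans (s≤s z≤n) n≥2) L (S-upward-%-closed x∈S x≤n^e^L (trans x≡1 (sym n^e^L≡1)))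
    where
    x≡1 : x % p ≡ 1
    x≡1 = trans x≡r^e^K (fermat-multiple r p-prime p∤r p∸1∣e^K)
    L = K + x
    n^e^L≡1 : n ^ (e ^ L) % p ≡ 1
    n^e^L≡1 = fermat-multiple n p-prime p∤n
      (subst (_ ∣_) (sym (^-distribˡ-+-* e K x)) (∣m⇒∣m*n (e ^ x) p∸1∣e^K))
    x≤n^e^L : x ≤ n ^ (e ^ L)
    x≤n^e^L = ≤-trans (m≤n+m x K) (≤-trans (<⇒≤ (m<b^m L e≥2)) (<⇒≤ (m<b^m (e ^ L) n≥2)))

  prime∧∤∧radDivides⇒maximal : Maximal p e r
  prime∧∤∧radDivides⇒maximal n = mk⇔ (λ s → S-≥2 r≥2 e≥1 s , S-∤ p-prime p∤r e≥1 s) (λ (n≥2 , p∤n) → S-complete n≥2 p∤n)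

theorem17 : (d e r : ℕ) → 2 ≤ d → 2 ≤ e → 2 ≤ r →
    Maximal d e r ⇔ (Prime d × ¬ (d ∣ r) × RadDivides (d ∸ 1) e)
theorem17 d e r d≥2 e≥2 r≥2 = mk⇔
  (λ maximal → let d-prime = maximal⇒prime maximal d≥2 e≥1 in
     d-prime , maximal⇒∤ maximal , maximal⇒radDivides maximal d≥2 e≥1 d-prime)
  (λ (d-prime , d∤r , rad) → prime∧∤∧radDivides⇒maximal d-prime e≥2 r≥2 d∤r rad)
  where
  e≥1 : 1 ≤ e
  e≥1 = ≤-trans (s≤s z≤n) e≥2
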